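{- Let $s\ge 0$ be an integer and consider the recursion $$C(n) = C\big(n-s-C(n-1)\big) + C\big(n-s-2-C(n-3)\big) \quad (n>r),$$ given $r\ge 3$ initial values $C(1),\dots,C(r)$ that are positive integers. Write $\Delta(n)=C(n)-C(n-1)$, $C_1(n)=C(n-s-C(n-1))$ and $C_2(n)=C(n-2-s-C(n-3))$. Suppose $m>r$ is such that $C(n)$ is defined and slow-growing up to term $m$ (i.e. $C(1),\dots,C(m)$ are defined and $\Delta(n)\in\{0,1\}$ for $2\le n\le m$), and that there is no $n$ with $3\le n\le m$ such that $\Delta(n)=\Delta(n-1)=1$. Then $C_1(n)-C_2(n)\in\{0,1\}$ for all $n$ with $r<n\le m$.
   Context: For $n>r$, the term $C(n)$ is defined by the recursion if the earlier terms needed are defined and the arguments $n-s-C(n-1)$ and $n-s-2-C(n-3)$ both lie in $[1,n-1]$. -}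

module Defs where

open import Data.Nat using (ℕ; zero; suc; _+_; _∸_; _≤_; _<_)
open import Data.Product using (_×_)
open import Data.Sum using (_⊎_)
open import Relation.Binary.PropositionalEquality using (_≡_)
open import Relation.Nullary using (¬_)

-- A sequence is modelled as a total function C : ℕ → ℕ ; only the values
-- C 1 , … , C m matter.  Index 0 is unused.

arg₁ : ℕ → (ℕ → ℕ) → ℕ → ℕ
arg₁ s C n = n ∸ (s + C (n ∸ 1))

arg₂ : ℕ → (ℕ → ℕ) → ℕ → ℕ
arg₂ s C n = n ∸ (s + 2 + C (n ∸ 3))

C₁ : ℕ → (ℕ → ℕ) → ℕ → ℕ
C₁ s C n = C (arg₁ s C n)

C₂ : ℕ → (ℕ → ℕ) → ℕ → ℕ
C₂ s C n = C (arg₂ s C n)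

-- C(1..m) is defined by the recursion with r positive initial values:
-- the initial values C 1 … C r are positive integers, and for r < n ≤ m both
-- arguments lie in [1, n-1] (as genuine integers, i.e. no truncation of ∸
-- occurs) and C n = C(arg₁) + C(arg₂).
DefinedUpTo : (s r : ℕ) → (ℕ → ℕ) → ℕ → Set
DefinedUpTo s r C m =
  (∀ i → 1 ≤ i → i ≤ r → 1 ≤ C i) ×
  (∀ n → r < n → n ≤ m →
     (s + C (n ∸ 1) < n) ×
     (1 ≤ arg₁ s C n) × (arg₁ s C n ≤ n ∸ 1) ×
     (s + 2 + C (n ∸ 3) < n) ×
     (1 ≤ arg₂ s C n) × (arg₂ s C n ≤ n ∸ 1) ×
     (C n ≡ C (arg₁ s C n) + C (arg₂ s C n)))

SlowUpTo : (ℕ → ℕ) → ℕ → Set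
SlowUpTo C m = ∀ n → 2 ≤ n → n ≤ m → (C n ≡ C (n ∸ 1)) ⊎ (C n ≡ suc (C (n ∸ 1)))

NoDoubleStepUpTo : (ℕ → ℕ) → ℕ → Set
NoDoubleStepUpTo C m = ∀ n → 3 ≤ n → n ≤ m →
  ¬ ((C n ≡ suc (C (n ∸ 1))) × (C (n ∸ 1) ≡ suc (C (n ∸ 2))))

module Submission where

-- A
-- slow-growing sequence C without two consecutive unit steps also grows by at
-- most one over every window of length two: C(j+2) - C(j) ∈ {0,1}.  This
-- single fact is used twice for r < n ≤ m:
--   * on the window n-3, n-1 it gives C(n-1) - C(n-3) ∈ {0,1}, hence the
--     recursion arguments  a₁ = n - s - C(n-1)  and  a₂ = n - s - 2 - C(n-3)
--     satisfy a₁ - a₂ = 2 - (C(n-1) - C(n-3)) ∈ {1,2};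
--   * on the window a₂, a₁ (of length one or two) it then gives
--     C(a₁) - C(a₂) ∈ {0,1}, i.e. C₁(n) - C₂(n) ∈ {0,1}.

open import Defs
open import Data.Nat using (ℕ; zero; suc; _+_; _∸_; _≤_; _<_; z≤n; s≤s)
open import Data.Nat.Properties using (≤-trans; n≤1+n; +-suc; +-assoc; m≤n⇒∃[o]m+o≡n)
open import Data.Product using (Σ; _×_; _,_)
open import Data.Sum using (_⊎_; inj₁; inj₂)
open import Relation.Binary.PropositionalEquality
  using (_≡_; refl; trans; cong; module ≡-Reasoning)
open import Data.Empty using (⊥-elim)
open import Relation.Nullary using (¬_)

UnitIncrement : ℕ → ℕ → Set
UnitIncrement x y = (y ≡ x) ⊎ (y ≡ suc x)

OneOrTwoAbove : ℕ → ℕ → Set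
OneOrTwoAbove a b = (b ≡ suc a) ⊎ (b ≡ suc (suc a))

compose-unit : ∀ {x y z} → UnitIncrement x y → UnitIncrement y z →
  ¬ ((z ≡ suc y) × (y ≡ suc x)) → UnitIncrement x z
compose-unit (inj₁ y≡x) (inj₁ z≡y) _ = inj₁ (trans z≡y y≡x)
compose-unit (inj₂ y≡1+x) (inj₁ z≡y) _ = inj₂ (trans z≡y y≡1+x)
compose-unit (inj₁ y≡x) (inj₂ z≡1+y) _ = inj₂ (trans z≡1+y (cong suc y≡x))
compose-unit (inj₂ y≡1+x) (inj₂ z≡1+y) notBoth = ⊥-elim (notBoth (z≡1+y , y≡1+x))

window-two : ∀ {C m j} → SlowUpTo C m → NoDoubleStepUpTo C m →
  1 ≤ j → suc (suc j) ≤ m → UnitIncrement (C j) (C (suc (suc j)))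
window-two {j = j} slow noDouble 1≤j j+2≤m =
  compose-unit (slow (suc j) (s≤s 1≤j) (≤-trans (n≤1+n (suc j)) j+2≤m))
               (slow (suc (suc j)) (s≤s (≤-trans 1≤j (n≤1+n j))) j+2≤m)
               (noDouble (suc (suc j)) (s≤s (s≤s 1≤j)) j+2≤m)

window-one-or-two : ∀ {C m a b} → SlowUpTo C m → NoDoubleStepUpTo C m →
  1 ≤ a → b ≤ m → OneOrTwoAbove a b → UnitIncrement (C a) (C b)
window-one-or-two slow noDouble 1≤a b≤m (inj₁ refl) = slow _ (s≤s 1≤a) b≤m
window-one-or-two slow noDouble 1≤a b≤m (inj₂ refl) =
  window-two slow noDouble 1≤a b≤m

∸-peel : ∀ a n → a < n → n ∸ a ≡ suc (n ∸ suc a)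
∸-peel zero    (suc n) _         = refl
∸-peel (suc a) (suc n) (s≤s a<n) = ∸-peel a n a<n

∸-gap : ∀ n d {e} → suc d < n → UnitIncrement d e →
  OneOrTwoAbove (n ∸ suc (suc d)) (n ∸ e)
∸-gap n d 1+d<n (inj₂ refl) = inj₁ (∸-peel (suc d) n 1+d<n)
∸-gap n d 1+d<n (inj₁ refl) = inj₂ (begin
  n ∸ d                         ≡⟨ ∸-peel d n (≤-trans (n≤1+n _) 1+d<n) ⟩
  suc (n ∸ suc d)               ≡⟨ cong suc (∸-peel (suc d) n 1+d<n) ⟩
  suc (suc (n ∸ suc (suc d)))   ∎)
  where open ≡-Reasoning

s+2+x≡2+[s+x] : ∀ s x → s + 2 + x ≡ suc (suc (s + x))
s+2+x≡2+[s+x] s x = trans (+-assoc s 2 x) (trans (+-suc s (suc x)) (cong suc (+-suc s x)))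

shift-unit : ∀ s {x y} → UnitIncrement x y → UnitIncrement (s + x) (s + y)
shift-unit s (inj₁ refl) = inj₁ refl
shift-unit s {x} (inj₂ refl) = inj₂ (+-suc s x)

-- If y is a unit increment of x and s + 2 + x < n, then n - (s + y) lies one
-- or two above n - (s + 2 + x).  With x = C(n-3), y = C(n-1) this compares
-- the two arguments of the recursion.
argument-gap : ∀ s n {x y} → s + 2 + x < n → UnitIncrement x y →
  OneOrTwoAbove (n ∸ (s + 2 + x)) (n ∸ (s + y))
argument-gap s n {x} bound y≈x rewrite s+2+x≡2+[s+x] s x =
  ∸-gap n (s + x) (≤-trans (n≤1+n _) bound) (shift-unit s y≈x)

-- Every n above r ≥ 3 has the form 3 + j with j ≥ 1, so that n - 1 = j + 2
-- and n - 3 = j hold definitionally.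
above-three : ∀ {r n} → 3 ≤ r → r < n → Σ ℕ λ j → (n ≡ 3 + j) × (1 ≤ j)
above-three 3≤r r<n with m≤n⇒∃[o]m+o≡n (≤-trans (s≤s 3≤r) r<n)
... | o , refl = suc o , refl , s≤s z≤n

lemma3p2 : (s r m : ℕ) (C : ℕ → ℕ) → 3 ≤ r → r < m →
    DefinedUpTo s r C m → SlowUpTo C m → NoDoubleStepUpTo C m →
    ∀ n → r < n → n ≤ m → (C₁ s C n ≡ C₂ s C n) ⊎ (C₁ s C n ≡ suc (C₂ s C n))
lemma3p2 s r m C 3≤r _ (_ , recursion) slow noDouble n r<n n≤m
  with above-three 3≤r r<n | recursion n r<n n≤m
... | j , refl , 1≤j | _ , _ , arg₁≤n-1 , arg₂-bound , 1≤arg₂ , _ =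
  window-one-or-two slow noDouble 1≤arg₂ arg₁≤m arguments-apart
  where
  n-1≤m : suc (suc j) ≤ m
  n-1≤m = ≤-trans (n≤1+n _) n≤m
  arguments-apart : OneOrTwoAbove (arg₂ s C n) (arg₁ s C n)
  arguments-apart =
    argument-gap s n arg₂-bound (window-two slow noDouble 1≤j n-1≤m)
  arg₁≤m : arg₁ s C n ≤ m
  arg₁≤m = ≤-trans arg₁≤n-1 n-1≤m
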